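{- Let $G$ be a finite $*$-graph in which every vertex has valency $4$ or $6$, and let $G'$ be an expansion of $G$. If $G'$ contains a Vassiliev obstruct, then $G$ contains a Vassiliev obstruct.
   Context: An unoriented cyclic order on a finite set $S$ with $|S|=n$ is a bijection $X:S\to V(C_n)$, $C_n$ the cycle graph on $n$ vertices. A $*$-graph is a finite graph (loops and multiple edges allowed) with, at each vertex $a$, an unoriented cyclic order $X_a$ of the half-edges at $a$. The expansion of a $6$-valent vertex $a$ with $*$-structure given by the cyclic order $(A,B,C,D,E,F)$ is obtained by choosing one of the two partitions into cyclically consecutive pairs, $\{A,B\},\{C,D\},\{E,F\}$ or $\{B,C\},\{D,E\},\{F,A\}$, and replacing $a$ by a triangle of new $4$-valent vertices $u,v,w$ (edges $uv,vw,wu$), where (in the first case) $u$ carries $A,B$, $v$ carries $C,D$, $w$ carries $E,F$, and the $*$-structures (cyclic orders) at the new vertices are $(A,B,uv,uw)$ at $u$, $(C,D,vw,vu)$ at $v$, $(E,F,wu,wv)$ at $w$ (the second case analogously with shifted labels). An expansion of a $*$-graph all of whose vertices have valency $4$ or $6$ is the $*$-graph (all vertices $4$-valent) obtained by replacing every $6$-valent vertex by an expansion of it. A cycle is a closed trail (closed walk using no edge twice; vertices may repeat). For two edge-disjoint cycles $A,B$, a crossing is an occurrence of a common vertex $a$ where $A$ passes through $a$ along half-edges $A_1,A_2$ and $B$ along half-edges $B_1,B_2$ with $X_a(A_1),X_a(B_1),X_a(A_2),X_a(B_2)$ appearing in this cyclic order in $C_n$; crossings are counted with multiplicity (each alternating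 pair of a passage of $A$ and a passage of $B$ counts once). A Vassiliev obstruct is a pair of edge-disjoint cycles with exactly one crossing (counted with multiplicity). -}

module Defs where

open import Data.Nat using (ℕ; zero; suc; _+_; _∸_; _<_; _≤ᵇ_)
open import Data.Fin using (Fin; zero; suc)
open import Data.Bool using (Bool; true; false; if_then_else_)
open import Data.Product using (Σ; _×_; _,_; proj₁; proj₂)
open import Data.Sum using (_⊎_; inj₁; inj₂)
open import Relation.Binary.PropositionalEquality using (_≡_; _≢_; subst; sym)
open import Function.Bundles using (_↔_)

-- A (possibly ill-formed) *-graph is given by a set V of vertices, a set
-- H of half-edges, the vertex  at h  carrying each half-edge, the
-- involution  mate  pairing the two half-edges of an edge (loops and
-- multiple edges allowed), the valency  deg a  of each vertex, and the
-- *-structure: X_a(h) = pos h ∈ {0,…,deg a - 1}, where the vertices of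
-- the cycle graph C_n are 0,1,…,n-1 in cyclic order.

record StarGraph : Set₁ where
  field
    V    : Set
    H    : Set
    at   : H → V
    mate : H → H
    deg  : V → ℕ
    pos  : H → ℕ

open StarGraph public

record WellFormed (G : StarGraph) : Set where
  field
    finV        : Σ ℕ λ n → V G ↔ Fin n
    finH        : Σ ℕ λ n → H G ↔ Fin n
    mate-invol  : ∀ h → mate G (mate G h) ≡ h
    mate-nofix  : ∀ h → mate G h ≢ h
    pos-bound   : ∀ h → pos G h < deg G (at G h)
    pos-inj     : ∀ h h' → at G h ≡ at G h' → pos G h ≡ pos G h' → h ≡ h'
    pos-surj    : ∀ a p → p < deg G a → Σ (H G) λ h → (at G h ≡ a) × (pos G h ≡ p)

fd : ℕ → ℕ → ℕ → ℕ
fd n x y = if x ≤ᵇ y then y ∸ x else (n + y) ∸ x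

-- x,y,z,w appear in this cyclic order in C_n: walking around C_n from x
-- in one of the two directions one meets y, then z, then w.
CyclicOrder : ℕ → ℕ → ℕ → ℕ → ℕ → Set
CyclicOrder n x y z w =
  ((fd n x y < fd n x z) × (fd n x z < fd n x w))
  ⊎ ((fd n y x < fd n z x) × (fd n z x < fd n w x))

-- Cycles = closed trails, given by the cyclic sequence of half-edges
-- step 0, …, step len along which the walk leaves its successive vertices.

next : {m : ℕ} → Fin (suc m) → Fin (suc m)
next {zero} zero = zero
next {suc m} zero = suc zero
next {suc m} (suc i) with next {m} i
... | zero = zero
... | suc j = suc (suc j)

record Cycle (G : StarGraph) : Set where
  field
    len   : ℕ
    step  : Fin (suc len) → H G
    walk  : ∀ i → at G (mate G (step i)) ≡ at G (step (next i))
    -- no edge is used twice (the edge of h is {h , mate h})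
    trail : ∀ i j → i ≢ j → (step i ≢ step j) × (step i ≢ mate G (step j))

open Cycle public

EdgeDisjoint : {G : StarGraph} → Cycle G → Cycle G → Set
EdgeDisjoint {G} A B =
  ∀ i j → (step A i ≢ step B j) × (step A i ≢ mate G (step B j))

-- The i-th passage of a cycle C goes through the vertex at (step C (next i))
-- along the half-edges  mate (step C i)  and  step C (next i).
-- Crossing of passage i of A with passage j of B.
Crossing : {G : StarGraph} → (A B : Cycle G) → Fin (suc (len A)) → Fin (suc (len B)) → Set
Crossing {G} A B i j =
  (at G (step A (next i)) ≡ at G (step B (next j))) ×
  CyclicOrder (deg G (at G (step A (next i))))
    (pos G (mate G (step A i))) (pos G (mate G (step B j)))
    (pos G (step A (next i)))   (pos G (step B (next j)))

VassilievObstruct : (G : StarGraph) → Set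
VassilievObstruct G =
  Σ (Cycle G) λ A → Σ (Cycle G) λ B → EdgeDisjoint A B ×
    Σ (Fin (suc (len A))) λ i → Σ (Fin (suc (len B))) λ j → Crossing A B i j ×
      (∀ i' j' → Crossing A B i' j' → (i' ≡ i) × (j' ≡ j))

is6 : ℕ → Bool
is6 6 = true
is6 _ = false

copies : ℕ → ℕ
copies d = if is6 d then 3 else 1

newdeg : ℕ → ℕ
newdeg 6 = 4
newdeg d = d

-- For a 6-valent vertex with cyclic order (A,B,C,D,E,F) = positions
-- 0..5: choice false = pairs {A,B},{C,D},{E,F} carried by u,v,w
-- (= 0,1,2); choice true = pairs {B,C},{D,E},{F,A}.
-- block: which new vertex carries the half-edge at position p.
block6 : Bool → ℕ → Fin 3
block6 false 0 = zero
block6 false 1 = zero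
block6 false 2 = suc zero
block6 false 3 = suc zero
block6 false 4 = suc (suc zero)
block6 false 5 = suc (suc zero)
block6 true  1 = zero
block6 true  2 = zero
block6 true  3 = suc zero
block6 true  4 = suc zero
block6 true  5 = suc (suc zero)
block6 true  0 = suc (suc zero)
block6 _     _ = zero

block : (d : ℕ) → Bool → ℕ → Fin (copies d)
block d b p with is6 d
... | true  = block6 b p
... | false = zero

newpos : ℕ → Bool → ℕ → ℕ
newpos 6 false 0 = 0
newpos 6 false 1 = 1
newpos 6 false 2 = 0
newpos 6 false 3 = 1
newpos 6 false 4 = 0
newpos 6 false 5 = 1
newpos 6 true  1 = 0
newpos 6 true  2 = 1
newpos 6 true  3 = 0
newpos 6 true  4 = 1
newpos 6 true  5 = 0
newpos 6 true  0 = 1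
newpos 6 _     p = p
newpos _ _     p = p

suc3 : Fin 3 → Fin 3
suc3 zero = suc zero
suc3 (suc zero) = suc (suc zero)
suc3 (suc (suc zero)) = zero

pred3 : Fin 3 → Fin 3
pred3 zero = suc (suc zero)
pred3 (suc zero) = zero
pred3 (suc (suc zero)) = suc zero

-- Triangle half-edges at a 6-valent vertex a: (a , k , true) is the
-- half-edge at the k-th new vertex towards the (k+1)-th one (position 2),
-- (a , k , false) the one towards the (k-1)-th (position 3).  So the new
-- vertex u=0 carries (A,B,uv,uw), v=1 carries (C,D,vw,vu), w=2 carries
-- (E,F,wu,wv) (for choice false; shifted for choice true).
SixV : StarGraph → Set
SixV G = Σ (V G) λ a → deg G a ≡ 6

expandV : StarGraph → Set
expandV G = Σ (V G) λ a → Fin (copies (deg G a))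

expandH : StarGraph → Set
expandH G = H G ⊎ (SixV G × Fin 3 × Bool)

expand : (G : StarGraph) → (V G → Bool) → StarGraph
expand G c = record
  { V    = expandV G
  ; H    = expandH G
  ; at   = at'
  ; mate = mate'
  ; deg  = λ v → newdeg (deg G (proj₁ v))
  ; pos  = pos'
  }
  where
  at' : expandH G → expandV G
  at' (inj₁ h) = at G h , block (deg G (at G h)) (c (at G h)) (pos G h)
  at' (inj₂ ((a , e) , k , _)) = a , subst (λ d → Fin (copies d)) (sym e) k

  mate' : expandH G → expandH G
  mate' (inj₁ h) = inj₁ (mate G h)
  mate' (inj₂ (s , k , true))  = inj₂ (s , suc3 k , false)
  mate' (inj₂ (s , k , false)) = inj₂ (s , pred3 k , true)

  pos' : expandH G → ℕ
  pos' (inj₁ h) = newpos (deg G (at G h)) (c (at G h)) (pos G h)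
  pos' (inj₂ (_ , _ , true))  = 2
  pos' (inj₂ (_ , _ , false)) = 3

-- A cycle of the expansion G′ alternates between original half-edges of G and runs of triangle
-- edges inside the triangles replacing 6-valent vertices.  A cycle made of triangle edges only
-- crosses nothing: at every corner it occupies both triangle half-edges, and these do not separate
-- the two original half-edges there.  Any other cycle contracts to a cycle of G by dropping its
-- triangle steps, and edge-disjoint cycles contract to edge-disjoint ones.  At a 4-valent vertex a
-- passage is unchanged by the expansion.  At a 6-valent vertex, two passages through the triangle
-- cross an odd number of times exactly when their end points alternate around the vertex, a finite
-- statement about one triangle that is checked by evaluation.  Hence the unique crossing of an
-- obstruct in G′ lies over a crossing of the contracted cycles, every crossing of the contracted
-- cycles lifts to a crossing in G′, and the contracted cycles form an obstruct in G.

module Submission where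

open import Defs
open import Data.Nat using (ℕ; zero; suc; pred; _+_; _<_; _≤_; _>_; _<ᵇ_; _≤ᵇ_; _<?_; z≤n; s≤s; >-nonZero)
open import Data.Nat.Properties
open import Data.Fin using (Fin; zero; suc; toℕ; fromℕ<)
open import Data.Fin.Properties using (toℕ-injective; toℕ<n; toℕ-fromℕ<; any?)
import Data.Fin.Properties as Fin
open import Data.Bool using (Bool; true; false; not; T; if_then_else_)
open import Data.Bool.Properties using (T-≡)
import Data.Bool.Properties as Bool
open import Data.Product using (∃; _×_; _,_; proj₁; proj₂)
open import Data.Sum using (_⊎_; inj₁; inj₂)
open import Data.Sum.Properties using (inj₁-injective)
open import Data.Empty using (⊥; ⊥-elim)
open import Function.Bundles using (Equivalence)
open import Relation.Nullary using (¬_; Dec; yes; no)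
open import Relation.Nullary.Decidable using (toWitness; ¬?; _×-dec_; _⊎-dec_; _→-dec_)
open import Relation.Binary.Definitions using (tri<; tri≈; tri>)
open import Relation.Binary.PropositionalEquality

next-cases : ∀ {m} (i : Fin (suc m)) →
             (suc (toℕ i) < suc m × toℕ (next i) ≡ suc (toℕ i)) ⊎ (toℕ i ≡ m × toℕ (next i) ≡ 0)
next-cases {zero}  zero = inj₂ (refl , refl)
next-cases {suc m} zero = inj₁ (s≤s (s≤s z≤n) , refl)
next-cases {suc m} (suc i) with next {m} i | next-cases {m} i
... | zero  | inj₂ (i≡m , _) = inj₂ (cong suc i≡m , refl)
... | suc j | inj₁ (i+1<m , eq) = inj₁ (s≤s i+1<m , cong suc eq)

next-injective : ∀ {m} (i j : Fin (suc m)) → next i ≡ next j → i ≡ j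
next-injective i j eq with next-cases i | next-cases j
... | inj₁ (_ , a) | inj₁ (_ , b) = toℕ-injective (suc-injective (trans (sym a) (trans (cong toℕ eq) b)))
... | inj₁ (_ , a) | inj₂ (_ , b) with () ← trans (sym a) (trans (cong toℕ eq) b)
... | inj₂ (_ , a) | inj₁ (_ , b) with () ← trans (sym b) (trans (cong toℕ (sym eq)) a)
... | inj₂ (a , _) | inj₂ (b , _) = toℕ-injective (trans a (sym b))

module Unrolling (m : ℕ) where

  N : ℕ
  N = suc m

  unroll : ℕ → Fin N
  unroll zero    = zero
  unroll (suc k) = next (unroll k)

  toℕ-unroll : ∀ k → k < N → toℕ (unroll k) ≡ k
  toℕ-unroll zero    _ = refl
  toℕ-unroll (suc k) k+1<N with next-cases (unroll k)
  ... | inj₁ (_ , eq) = trans eq (cong suc (toℕ-unroll k (<⇒≤ k+1<N)))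
  ... | inj₂ (eq , _) =
    ⊥-elim (<-irrefl (trans (sym (toℕ-unroll k (<⇒≤ k+1<N))) eq) (≤-pred k+1<N))

  unroll-toℕ : (i : Fin N) → unroll (toℕ i) ≡ i
  unroll-toℕ i = toℕ-injective (toℕ-unroll (toℕ i) (toℕ<n i))

  unroll-N : unroll N ≡ zero
  unroll-N with next-cases (unroll m)
  ... | inj₁ (m+1<N , _) = ⊥-elim (<-irrefl (cong suc (toℕ-unroll m ≤-refl)) m+1<N)
  ... | inj₂ (_ , eq)    = toℕ-injective eq

  unroll-periodic : ∀ k → unroll (k + N) ≡ unroll k
  unroll-periodic zero    = unroll-N
  unroll-periodic (suc k) = cong next (unroll-periodic k)

  private
    unroll-shift-≢ : ∀ x d → 0 < d → d < N → unroll (x + d) ≢ unroll x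
    unroll-shift-≢ zero    d 0<d d<N eq =
      <-irrefl (sym (trans (sym (toℕ-unroll d d<N)) (cong toℕ eq))) 0<d
    unroll-shift-≢ (suc x) d 0<d d<N eq = unroll-shift-≢ x d 0<d d<N (next-injective _ _ eq)

    unroll-injective-≤ : ∀ x y → x ≤ y → y < x + N → unroll x ≡ unroll y → x ≡ y
    unroll-injective-≤ x y x≤y y<x+N eq with m≤n⇒∃[o]m+o≡n x≤y
    ... | zero  , refl = sym (+-identityʳ x)
    ... | suc d , refl = ⊥-elim (unroll-shift-≢ x (suc d) (s≤s z≤n) (+-cancelˡ-< x _ _ y<x+N) (sym eq))

  unroll-injective : ∀ {a x y} → a ≤ x → x < a + N → a ≤ y → y < a + N →
                     unroll x ≡ unroll y → x ≡ y
  unroll-injective {a} {x} {y} a≤x x<a+N a≤y y<a+N eq with ≤-total x y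
  ... | inj₁ x≤y = unroll-injective-≤ x y x≤y (<-≤-trans y<a+N (+-monoˡ-≤ N a≤x)) eq
  ... | inj₂ y≤x = sym (unroll-injective-≤ y x y≤x (<-≤-trans x<a+N (+-monoˡ-≤ N a≤y)) (sym eq))

  unroll-surjective : (i : Fin N) → ∀ a → ∃ λ k → a ≤ k × k < a + N × unroll k ≡ i
  unroll-surjective i zero    = toℕ i , z≤n , toℕ<n i , unroll-toℕ i
  unroll-surjective i (suc a) with unroll-surjective i a
  ... | k , a≤k , k<a+N , eq with m≤n⇒m<n∨m≡n a≤k
  ...   | inj₁ a<k  = k , a<k , ≤-trans k<a+N (n≤1+n _) , eq
  ...   | inj₂ refl = a + N , ≤-trans (s≤s (m≤m+n a m)) (≤-reflexive (sym (+-suc a m))) , ≤-refl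
                      , trans (unroll-periodic a) eq

firstTrue : (ℕ → Bool) → ℕ → ℕ
firstTrue P zero    = zero
firstTrue P (suc B) with P zero
... | true  = zero
... | false = suc (firstTrue (λ j → P (suc j)) B)

firstTrue-≤ : ∀ (P : ℕ → Bool) B → firstTrue P B ≤ B
firstTrue-≤ P zero    = z≤n
firstTrue-≤ P (suc B) with P zero
... | true  = z≤n
... | false = s≤s (firstTrue-≤ _ B)

firstTrue-minimal : ∀ (P : ℕ → Bool) B {j} → j < firstTrue P B → P j ≡ false
firstTrue-minimal P (suc B) {j} j<first with P zero in eq
firstTrue-minimal P (suc B) {zero}  _           | false = eq
firstTrue-minimal P (suc B) {suc j} (s≤s j<first) | false = firstTrue-minimal (λ j → P (suc j)) B j<first

firstTrue-true : ∀ (P : ℕ → Bool) B {w} → w ≤ B → P w ≡ true → P (firstTrue P B) ≡ true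
firstTrue-true P zero    z≤n Pw = Pw
firstTrue-true P (suc B) {w} w≤B Pw with P zero in eq
firstTrue-true P (suc B) {w}     w≤B       Pw | true  = eq
firstTrue-true P (suc B) {zero}  _         Pw | false with () ← trans (sym Pw) eq
firstTrue-true P (suc B) {suc w} (s≤s w≤B) Pw | false = firstTrue-true (λ j → P (suc j)) B w≤B Pw

edgeDisjoint-sym : ∀ {G} → (∀ h → mate G (mate G h) ≡ h) → {A B : Cycle G} →
                   EdgeDisjoint A B → EdgeDisjoint B A
edgeDisjoint-sym {G} mate-involutive {A} {B} disjoint j i =
  (λ eq → proj₁ (disjoint i j) (sym eq)) ,
  (λ eq → proj₂ (disjoint i j) (trans (sym (mate-involutive (step A i))) (cong (mate G) (sym eq))))

module Unrolled {G : StarGraph}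
                (mate-involutive : ∀ h → mate G (mate G h) ≡ h)
                (mate-fixedPointFree : ∀ h → mate G h ≢ h)
                (C : Cycle G) where
  open Unrolling (len C) public

  stepAt : ℕ → H G
  stepAt k = step C (unroll k)

  stepAt-walk : ∀ k → at G (mate G (stepAt k)) ≡ at G (stepAt (suc k))
  stepAt-walk k = walk C (unroll k)

  stepAt-periodic : ∀ k → stepAt (k + N) ≡ stepAt k
  stepAt-periodic k = cong (step C) (unroll-periodic k)

  stepAt-trail : ∀ {x y} → x < y → y < x + N →
                 (stepAt x ≢ stepAt y) × (stepAt x ≢ mate G (stepAt y))
  stepAt-trail {x} {y} x<y y<x+N =
    trail C (unroll x) (unroll y) λ eq →
      <-irrefl (unroll-injective ≤-refl (<-≤-trans x<y (<⇒≤ y<x+N)) (<⇒≤ x<y) y<x+N eq) x<y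

  stepAt-trail-≢ : ∀ {a x y} → a ≤ x → x < a + N → a ≤ y → y < a + N → x ≢ y →
                   (stepAt x ≢ stepAt y) × (stepAt x ≢ mate G (stepAt y))
  stepAt-trail-≢ {x = x} {y} a≤x x<a+N a≤y y<a+N x≢y with <-cmp x y
  ... | tri< x<y _ _ = stepAt-trail x<y (<-≤-trans y<a+N (+-monoˡ-≤ N a≤x))
  ... | tri≈ _ x≡y _ = ⊥-elim (x≢y x≡y)
  ... | tri> _ _ y<x =
    (λ eq → proj₁ trail-yx (sym eq)) ,
    (λ eq → proj₂ trail-yx (trans (sym (mate-involutive (stepAt y))) (cong (mate G) (sym eq))))
    where
    trail-yx : (stepAt y ≢ stepAt x) × (stepAt y ≢ mate G (stepAt x))
    trail-yx = stepAt-trail y<x (<-≤-trans x<a+N (+-monoˡ-≤ N a≤y))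

  no-backtracking : ∀ k → stepAt (suc k) ≢ mate G (stepAt k)
  no-backtracking k eq = go (len C) refl
    where
    go : ∀ n → len C ≡ n → ⊥
    go zero    len≡0 = mate-fixedPointFree (stepAt k) (sym (begin
      stepAt k           ≡⟨ sym (stepAt-periodic k) ⟩
      stepAt (k + N)     ≡⟨ cong stepAt (trans (+-suc k (len C)) (cong (λ n → suc (k + n)) len≡0)) ⟩
      stepAt (suc (k + 0)) ≡⟨ cong (λ n → stepAt (suc n)) (+-identityʳ k) ⟩
      stepAt (suc k)     ≡⟨ eq ⟩
      mate G (stepAt k)  ∎))
      where open ≡-Reasoning
    go (suc n) len≡1+n = proj₂ (stepAt-trail ≤-refl k+1<k+N)
      (trans (sym (mate-involutive (stepAt k))) (cong (mate G) (sym eq)))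
      where
      k+1<k+N : suc k < k + N
      k+1<k+N = subst (λ n → suc k < k + suc n) (sym len≡1+n)
                  (subst (_< k + suc (suc n)) (+-comm k 1) (+-monoʳ-< k (s≤s (s≤s z≤n))))

  no-backtracking-at : ∀ i → step C (next i) ≢ mate G (step C i)
  no-backtracking-at i = subst (λ i → step C (next i) ≢ mate G (step C i)) (unroll-toℕ i) (no-backtracking (toℕ i))

cyclicOrder? : ∀ n x y z w → Dec (CyclicOrder n x y z w)
cyclicOrder? n x y z w =
  ((fd n x y <? fd n x z) ×-dec (fd n x z <? fd n x w)) ⊎-dec
  ((fd n y x <? fd n z x) ×-dec (fd n z x <? fd n w x))

cyclicOrder-cong : ∀ {n n′ x x′ y y′ z z′ w w′} →
                   n ≡ n′ → x ≡ x′ → y ≡ y′ → z ≡ z′ → w ≡ w′ → CyclicOrder n x y z w → CyclicOrder n′ x′ y′ z′ w′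
cyclicOrder-cong refl refl refl refl refl co = co

turn : Bool → Fin 3 → Fin 3
turn true  = suc3
turn false = pred3

pred3-suc3 : ∀ k → pred3 (suc3 k) ≡ k
pred3-suc3 zero             = refl
pred3-suc3 (suc zero)       = refl
pred3-suc3 (suc (suc zero)) = refl

suc3-pred3 : ∀ k → suc3 (pred3 k) ≡ k
suc3-pred3 zero             = refl
suc3-pred3 (suc zero)       = refl
suc3-pred3 (suc (suc zero)) = refl

turn³ : ∀ d k → turn d (turn d (turn d k)) ≡ k
turn³ true  zero             = refl
turn³ true  (suc zero)       = refl
turn³ true  (suc (suc zero)) = refl
turn³ false zero             = refl
turn³ false (suc zero)       = refl
turn³ false (suc (suc zero)) = refl

-- Local model of the triangle replacing a 6-valent vertex with expansion choice b: outer p is the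
-- original half-edge at position p, inner k d the triangle half-edge at corner k pointing in
-- direction d (towards corner k + 1 if d is true).  A passage enters through outer entry, runs
-- along steps triangle edges in direction dir and leaves through outer exit.
data Slot : Set where
  outer : ℕ → Slot
  inner : Fin 3 → Bool → Slot

_≟-slot_ : (u v : Slot) → Dec (u ≡ v)
outer p ≟-slot outer q with p ≟ q
... | yes refl = yes refl
... | no p≢q   = no λ { refl → p≢q refl }
outer _ ≟-slot inner _ _ = no λ ()
inner _ _ ≟-slot outer _ = no λ ()
inner k d ≟-slot inner k′ d′ with k Fin.≟ k′ | d Bool.≟ d′
... | yes refl | yes refl = yes refl
... | no k≢k′  | _        = no λ { refl → k≢k′ refl }
... | _        | no d≢d′  = no λ { refl → d≢d′ refl }

innerPos : Bool → ℕ
innerPos true  = 2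
innerPos false = 3

slotPos : Bool → Slot → ℕ
slotPos b (outer p)   = newpos 6 b p
slotPos b (inner _ d) = innerPos d

slotCorner : Bool → Slot → Fin 3
slotCorner b (outer p)   = block6 b p
slotCorner b (inner k _) = k

slotMate : Slot → Slot
slotMate (outer p)       = outer p
slotMate (inner k true)  = inner (suc3 k) false
slotMate (inner k false) = inner (pred3 k) true

record Passage : Set where
  constructor passage
  field
    entry exit steps : ℕ
    dir : Bool
open Passage

corner : Bool → Passage → ℕ → Fin 3
corner b P zero    = block6 b (entry P)
corner b P (suc t) = turn (dir P) (corner b P t)

innerStep : Bool → Passage → ℕ → Slot
innerStep b P t = inner (corner b P t) (dir P)

inSlot : Bool → Passage → ℕ → Slot
inSlot b P zero    = outer (entry P)
inSlot b P (suc t) = slotMate (innerStep b P t)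

outSlot : Bool → Passage → ℕ → Slot
outSlot b P t = if t <ᵇ steps P then innerStep b P t else outer (exit P)

Proper : Bool → Passage → Set
Proper b P = (entry P < 6) × (exit P < 6) × (steps P < 4) × ¬ (entry P ≡ exit P)
           × (block6 b (exit P) ≡ corner b P (steps P))

EdgeDisjointPassages : Bool → Passage → Passage → Set
EdgeDisjointPassages b P Q =
  ¬ (entry P ≡ entry Q) × ¬ (entry P ≡ exit Q) × ¬ (exit P ≡ entry Q) × ¬ (exit P ≡ exit Q) ×
  (∀ {t} → t < steps P → ∀ {l} → l < steps Q →
     ¬ (innerStep b P t ≡ innerStep b Q l) × ¬ (innerStep b P t ≡ slotMate (innerStep b Q l)))

LocalCrossing : Bool → Passage → Passage → ℕ → ℕ → Set
LocalCrossing b P Q t l =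
  (slotCorner b (outSlot b P t) ≡ slotCorner b (outSlot b Q l)) ×
  CyclicOrder 4 (slotPos b (inSlot b P t)) (slotPos b (inSlot b Q l))
                (slotPos b (outSlot b P t)) (slotPos b (outSlot b Q l))

Alternating : Passage → Passage → Set
Alternating P Q = CyclicOrder 6 (entry P) (entry Q) (exit P) (exit Q)

SomeLocalCrossing : Bool → Passage → Passage → Set
SomeLocalCrossing b P Q = ∃ λ t → t < suc (steps P) × ∃ λ l → l < suc (steps Q) × LocalCrossing b P Q t l

UniqueLocalCrossing : Bool → Passage → Passage → ℕ → ℕ → Set
UniqueLocalCrossing b P Q t l =
  ∀ {t′} → t′ < suc (steps P) → ∀ {l′} → l′ < suc (steps Q) →
  LocalCrossing b P Q t′ l′ → (t′ ≡ t) × (l′ ≡ l)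

-- Two passages through a triangle cross an odd number of times exactly when their end points
-- alternate; these are the two consequences that are used.
ParityLaw : Bool → Passage → Passage → Set
ParityLaw b P Q =
  (Alternating P Q → SomeLocalCrossing b P Q) ×
  (∀ {t} → t < suc (steps P) → ∀ {l} → l < suc (steps Q) →
     LocalCrossing b P Q t l → UniqueLocalCrossing b P Q t l → Alternating P Q)

proper? : ∀ b P → Dec (Proper b P)
proper? b P = (entry P <? 6) ×-dec (exit P <? 6) ×-dec (steps P <? 4) ×-dec ¬? (entry P ≟ exit P)
            ×-dec (block6 b (exit P) Fin.≟ corner b P (steps P))

edgeDisjointPassages? : ∀ b P Q → Dec (EdgeDisjointPassages b P Q)
edgeDisjointPassages? b P Q =
  ¬? (entry P ≟ entry Q) ×-dec ¬? (entry P ≟ exit Q) ×-dec ¬? (exit P ≟ entry Q) ×-dec ¬? (exit P ≟ exit Q) ×-dec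
  allUpTo? (λ t → allUpTo? (λ l → ¬? (innerStep b P t ≟-slot innerStep b Q l)
                               ×-dec ¬? (innerStep b P t ≟-slot slotMate (innerStep b Q l))) (steps Q)) (steps P)

localCrossing? : ∀ b P Q t l → Dec (LocalCrossing b P Q t l)
localCrossing? b P Q t l =
  (slotCorner b (outSlot b P t) Fin.≟ slotCorner b (outSlot b Q l)) ×-dec
  cyclicOrder? 4 (slotPos b (inSlot b P t)) (slotPos b (inSlot b Q l))
                 (slotPos b (outSlot b P t)) (slotPos b (outSlot b Q l))

parityLaw? : ∀ b P Q → Dec (ParityLaw b P Q)
parityLaw? b P Q =
  (alternating? →-dec
     anyUpTo? (λ t → anyUpTo? (λ l → localCrossing? b P Q t l) (suc (steps Q))) (suc (steps P)))
  ×-dec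
  allUpTo? (λ t → allUpTo? (λ l → localCrossing? b P Q t l →-dec unique? t l →-dec alternating?) (suc (steps Q))) (suc (steps P))
  where
  alternating? : Dec (Alternating P Q)
  alternating? = cyclicOrder? 6 (entry P) (entry Q) (exit P) (exit Q)
  unique? : ∀ t l → Dec (UniqueLocalCrossing b P Q t l)
  unique? t l = allUpTo? (λ t′ → allUpTo? (λ l′ → localCrossing? b P Q t′ l′ →-dec (t′ ≟ t ×-dec l′ ≟ l))
                                           (suc (steps Q))) (suc (steps P))

∀-Bool? : {A : Bool → Set} → (∀ b → Dec (A b)) → Dec (∀ b → A b)
∀-Bool? A? with A? false | A? true
... | yes f | yes t = yes λ { false → f ; true → t }
... | no ¬f | _     = no λ all → ¬f (all false)
... | _     | no ¬t = no λ all → ¬t (all true)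

AllPassages : (Passage → Set) → Set
AllPassages A = ∀ {e} → e < 6 → ∀ {x} → x < 6 → ∀ {m} → m < 4 → ∀ d → A (passage e x m d)

allPassages? : {A : Passage → Set} → (∀ P → Dec (A P)) → Dec (AllPassages A)
allPassages? A? = allUpTo? (λ e → allUpTo? (λ x → allUpTo? (λ m → ∀-Bool? (λ d → A? (passage e x m d))) 4) 6) 6

ParityLawHolds : Bool → Set
ParityLawHolds b =
  AllPassages λ P → Proper b P → AllPassages λ Q → Proper b Q → EdgeDisjointPassages b P Q → ParityLaw b P Q

parityLawHolds : ∀ b → ParityLawHolds b
parityLawHolds = toWitness {a? = ∀-Bool? λ b →
  allPassages? λ P → proper? b P →-dec allPassages? λ Q → proper? b Q →-dec
  (edgeDisjointPassages? b P Q →-dec parityLaw? b P Q)} _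

outerPos<2 : ∀ b {p} → p < 6 → newpos 6 b p < 2
outerPos<2 = toWitness {a? = ∀-Bool? λ b → allUpTo? (λ p → newpos 6 b p <? 2) 6} _

triangleSidesDoNotInterleave : ∀ d {y} → y < 2 → ∀ {w} → w < 2 →
  ¬ CyclicOrder 4 (innerPos (not d)) y (innerPos d) w × ¬ CyclicOrder 4 y (innerPos (not d)) w (innerPos d)
triangleSidesDoNotInterleave = toWitness {a? = ∀-Bool? λ d → allUpTo? (λ y → allUpTo? (λ w →
  ¬? (cyclicOrder? 4 (innerPos (not d)) y (innerPos d) w) ×-dec ¬? (cyclicOrder? 4 y (innerPos (not d)) w (innerPos d))) 2) 2} _

parityLaw : ∀ b P Q → Proper b P → Proper b Q → EdgeDisjointPassages b P Q → ParityLaw b P Q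
parityLaw b P Q properP@(e<6 , x<6 , m<4 , _) properQ@(e′<6 , x′<6 , m′<4 , _) =
  parityLawHolds b e<6 x<6 m<4 (dir P) properP e′<6 x′<6 m′<4 (dir Q) properQ

outSlot-< : ∀ b P {t} → t < steps P → outSlot b P t ≡ innerStep b P t
outSlot-< b P {t} t<m with t <ᵇ steps P | <⇒<ᵇ t<m
... | true | _ = refl

outSlot-steps : ∀ b P → outSlot b P (steps P) ≡ outer (exit P)
outSlot-steps b P with steps P <ᵇ steps P | <ᵇ⇒< (steps P) (steps P)
... | false | _ = refl
... | true  | m<m = ⊥-elim (<-irrefl refl (m<m _))

toℕ-subst-copies : ∀ {d d′} (eq : d ≡ d′) (k : Fin (copies d)) →
                   toℕ (subst (λ d → Fin (copies d)) eq k) ≡ toℕ k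
toℕ-subst-copies refl k = refl

block-6 : ∀ {d} → d ≡ 6 → ∀ b p → toℕ (block d b p) ≡ toℕ (block6 b p)
block-6 refl b p = refl

block-4 : ∀ {d} → d ≡ 4 → ∀ b p → toℕ (block d b p) ≡ 0
block-4 refl b p = refl

newpos-6 : ∀ {d} → d ≡ 6 → ∀ b p → newpos d b p ≡ newpos 6 b p
newpos-6 refl _ _ = refl

newpos-4 : ∀ {d} → d ≡ 4 → ∀ b p → newpos d b p ≡ p
newpos-4 refl _ _ = refl

newdeg-4 : ∀ {d} → d ≡ 4 → newdeg d ≡ 4
newdeg-4 refl = refl

newdeg-6 : ∀ {d} → d ≡ 6 → newdeg d ≡ 4
newdeg-6 refl = refl

module Expansion (G : StarGraph) (wf : WellFormed G) (c : V G → Bool) where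
  open WellFormed wf

  G′ : StarGraph
  G′ = expand G c

  H′ : Set
  H′ = H G′

  at′ : H′ → V G′
  at′ = at G′

  mate′ : H′ → H′
  mate′ = mate G′

  pos′ : H′ → ℕ
  pos′ = pos G′

  base : H′ → V G
  base e = proj₁ (at′ e)

  cornerOf : V G′ → ℕ
  cornerOf v = toℕ (proj₂ v)

  vertex-≡ : ∀ (v w : V G′) → proj₁ v ≡ proj₁ w → cornerOf v ≡ cornerOf w → v ≡ w
  vertex-≡ (a , k) (.a , k′) refl eq = cong (a ,_) (toℕ-injective eq)

  mate′-involutive : ∀ e → mate′ (mate′ e) ≡ e
  mate′-involutive (inj₁ h)              = cong inj₁ (mate-invol h)
  mate′-involutive (inj₂ (s , k , true))  = cong (λ k → inj₂ (s , k , true)) (pred3-suc3 k)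
  mate′-involutive (inj₂ (s , k , false)) = cong (λ k → inj₂ (s , k , false)) (suc3-pred3 k)

  mate′-fixedPointFree : ∀ e → mate′ e ≢ e
  mate′-fixedPointFree (inj₁ h) eq = mate-nofix h (inj₁-injective eq)
  mate′-fixedPointFree (inj₂ (s , k , true))  ()
  mate′-fixedPointFree (inj₂ (s , k , false)) ()

  isOriginal : H′ → Bool
  isOriginal (inj₁ _) = true
  isOriginal (inj₂ _) = false

  Triangular : H′ → Set
  Triangular e = isOriginal e ≡ false

  original : (e : H′) → isOriginal e ≡ true → H G
  original (inj₁ h) _ = h

  inj₁-original : ∀ e o → inj₁ (original e o) ≡ e
  inj₁-original (inj₁ h) _ = refl

  triCorner : H′ → Fin 3
  triCorner (inj₁ _)           = zero
  triCorner (inj₂ (_ , k , _)) = k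

  triDir : H′ → Bool
  triDir (inj₁ _)           = false
  triDir (inj₂ (_ , _ , d)) = d

  slotOf : H′ → Slot
  slotOf (inj₁ h)           = outer (pos G h)
  slotOf (inj₂ (_ , k , d)) = inner k d

  mate-triangular : ∀ e → Triangular e → Triangular (mate′ e)
  mate-triangular (inj₂ (_ , _ , true))  _ = refl
  mate-triangular (inj₂ (_ , _ , false)) _ = refl

  base-mate-triangular : ∀ e → Triangular e → base (mate′ e) ≡ base e
  base-mate-triangular (inj₂ (_ , _ , true))  _ = refl
  base-mate-triangular (inj₂ (_ , _ , false)) _ = refl

  triangular-deg : ∀ e → Triangular e → deg G (base e) ≡ 6
  triangular-deg (inj₂ ((_ , a6) , _ , _)) _ = a6

  cornerOf-triangular : ∀ e → Triangular e → cornerOf (at′ e) ≡ toℕ (triCorner e)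
  cornerOf-triangular (inj₂ ((_ , a6) , k , _)) _ = toℕ-subst-copies (sym a6) k

  cornerOf-mate-triangular : ∀ e → Triangular e → cornerOf (at′ (mate′ e)) ≡ toℕ (turn (triDir e) (triCorner e))
  cornerOf-mate-triangular (inj₂ ((_ , a6) , k , true))  _ = toℕ-subst-copies (sym a6) (suc3 k)
  cornerOf-mate-triangular (inj₂ ((_ , a6) , k , false)) _ = toℕ-subst-copies (sym a6) (pred3 k)

  slotOf-triangular : ∀ e → Triangular e → slotOf e ≡ inner (triCorner e) (triDir e)
  slotOf-triangular (inj₂ _) _ = refl

  slotOf-mate-triangular : ∀ e → Triangular e → slotOf (mate′ e) ≡ slotMate (slotOf e)
  slotOf-mate-triangular (inj₂ (_ , _ , true))  _ = refl
  slotOf-mate-triangular (inj₂ (_ , _ , false)) _ = refl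

  triDir-mate-triangular : ∀ e → Triangular e → triDir (mate′ e) ≡ not (triDir e)
  triDir-mate-triangular (inj₂ (_ , _ , true))  _ = refl
  triDir-mate-triangular (inj₂ (_ , _ , false)) _ = refl

  pos-triangular : ∀ e → Triangular e → pos′ e ≡ innerPos (triDir e)
  pos-triangular (inj₂ (_ , _ , true))  _ = refl
  pos-triangular (inj₂ (_ , _ , false)) _ = refl

  pos-mate-triangular : ∀ e → Triangular e → pos′ (mate′ e) ≡ innerPos (not (triDir e))
  pos-mate-triangular (inj₂ (_ , _ , true))  _ = refl
  pos-mate-triangular (inj₂ (_ , _ , false)) _ = refl

  triCorner-at : ∀ {e f} → Triangular e → Triangular f → at′ e ≡ at′ f → triCorner e ≡ triCorner f
  triCorner-at {e} {f} te tf eq =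
    toℕ-injective (trans (sym (cornerOf-triangular e te)) (trans (cong cornerOf eq) (cornerOf-triangular f tf)))

  triangular-slot-≡ : ∀ {e f} → Triangular e → Triangular f → base e ≡ base f → slotOf e ≡ slotOf f → e ≡ f
  triangular-slot-≡ {inj₂ ((a , a6) , k , d)} {inj₂ ((.a , a6′) , .k , .d)} _ _ refl refl =
    cong (λ a6 → inj₂ ((a , a6) , k , d)) (≡-irrelevant a6 a6′)

  triangular-≡ : ∀ {e f} → Triangular e → Triangular f → at′ e ≡ at′ f → triDir e ≡ triDir f → e ≡ f
  triangular-≡ {e} {f} te tf eq d≡d′ = triangular-slot-≡ te tf (cong proj₁ eq)
    (trans (slotOf-triangular e te) (trans (cong₂ inner (triCorner-at te tf eq) d≡d′) (sym (slotOf-triangular f tf))))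

  triangular-at-mate : ∀ {e f} → Triangular e → Triangular f → at′ f ≡ at′ (mate′ e) →
                       f ≡ mate′ e ⊎ triDir f ≡ triDir e
  triangular-at-mate {e} {f} te tf eq with triDir f Bool.≟ triDir e
  ... | yes same = inj₂ same
  ... | no  diff = inj₁ (triangular-≡ tf (mate-triangular e te) eq
                          (trans (Bool.¬-not diff) (sym (triDir-mate-triangular e te))))

  triDir-step : ∀ {e f} → Triangular e → Triangular f → at′ (mate′ e) ≡ at′ f → f ≢ mate′ e →
                triDir f ≡ triDir e
  triDir-step te tf eq f≢ with triangular-at-mate te tf (sym eq)
  ... | inj₁ f≡ = ⊥-elim (f≢ f≡)
  ... | inj₂ same = same

  pos-beside-step : ∀ {e f g} → Triangular e → Triangular f → at′ (mate′ e) ≡ at′ f → triDir f ≡ triDir e →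
                    at′ g ≡ at′ f → g ≢ f → g ≢ mate′ e → pos′ g < 2
  pos-beside-step {g = inj₁ h} _ tf _ _ g≡ _ _ =
    subst (_< 2) (sym (newpos-6 h6 _ _)) (outerPos<2 _ (subst (pos G h <_) h6 (pos-bound h)))
    where
    h6 : deg G (at G h) ≡ 6
    h6 = trans (cong (λ v → deg G (proj₁ v)) g≡) (triangular-deg _ tf)
  pos-beside-step {g = inj₂ _} te tf step same-dir g≡ g≢f g≢mate with triangular-at-mate te refl (trans g≡ (sym step))
  ... | inj₁ g≡mate = ⊥-elim (g≢mate g≡mate)
  ... | inj₂ same   = ⊥-elim (g≢f (triangular-≡ refl tf g≡ (trans same (sym same-dir))))

  module LocalCoordinates {a : V G} (six : deg G a ≡ 6) where

    corner-slot : ∀ e → base e ≡ a → cornerOf (at′ e) ≡ toℕ (slotCorner (c a) (slotOf e))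
    corner-slot (inj₁ h) refl = block-6 six _ _
    corner-slot e@(inj₂ _) _  = cornerOf-triangular e refl

    pos-slot : ∀ e → base e ≡ a → pos′ e ≡ slotPos (c a) (slotOf e)
    pos-slot (inj₁ h) refl = newpos-6 six _ _
    pos-slot e@(inj₂ _) _  = pos-triangular e refl

  module Walk (C : Cycle G′) = Unrolled mate′-involutive mate′-fixedPointFree C

  -- At each corner such a cycle occupies positions 2 and 3, so every other cycle passing there
  -- uses positions 0 and 1, and the two pairs do not interleave.
  module TriangleCycle (C : Cycle G′) (triangular : ∀ i → Triangular (step C i)) where

    triDir-constant : ∀ i → triDir (step C (next i)) ≡ triDir (step C i)
    triDir-constant i = triDir-step (triangular i) (triangular (next i)) (walk C i) (Walk.no-backtracking-at C i)

    module _ (B : Cycle G′) (disjoint : EdgeDisjoint C B) (i : Fin (suc (len C))) (j : Fin (suc (len B)))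
             (meet : at′ (step C (next i)) ≡ at′ (step B (next j))) where

      private
        pos-foreign : ∀ g → at′ g ≡ at′ (step C (next i)) → g ≢ step C (next i) → g ≢ mate′ (step C i) →
                      pos′ g < 2
        pos-foreign g = pos-beside-step (triangular i) (triangular (next i)) (walk C i) (triDir-constant i)

      pos-foreign-in : pos′ (mate′ (step B j)) < 2
      pos-foreign-in = pos-foreign _ (trans (walk B j) (sym meet))
        (λ eq → proj₂ (disjoint (next i) j) (sym eq))
        (λ eq → proj₁ (disjoint i j) (trans (sym (mate′-involutive _)) (trans (cong mate′ (sym eq)) (mate′-involutive _))))

      pos-foreign-out : pos′ (step B (next j)) < 2
      pos-foreign-out = pos-foreign _ (sym meet)
        (λ eq → proj₁ (disjoint (next i) (next j)) (sym eq))
        (λ eq → proj₂ (disjoint i (next j)) (trans (sym (mate′-involutive _)) (cong mate′ (sym eq))))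

    private
      deg-corner : ∀ i → deg G′ (at′ (step C (next i))) ≡ 4
      deg-corner i = newdeg-6 (triangular-deg _ (triangular (next i)))

      pos-in : ∀ i → pos′ (mate′ (step C i)) ≡ innerPos (not (triDir (step C i)))
      pos-in i = pos-mate-triangular _ (triangular i)

      pos-out : ∀ i → pos′ (step C (next i)) ≡ innerPos (triDir (step C i))
      pos-out i = trans (pos-triangular _ (triangular (next i))) (cong innerPos (triDir-constant i))

    no-crossing-left : ∀ B → EdgeDisjoint C B → ∀ i j → ¬ Crossing C B i j
    no-crossing-left B disjoint i j (meet , co) =
      proj₁ (triangleSidesDoNotInterleave (triDir (step C i))
               (pos-foreign-in B disjoint i j meet) (pos-foreign-out B disjoint i j meet))
        (cyclicOrder-cong (deg-corner i) (pos-in i) refl (pos-out i) refl co)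

    no-crossing-right : ∀ A → EdgeDisjoint A C → ∀ i j → ¬ Crossing A C i j
    no-crossing-right A disjoint i j (meet , co) =
      proj₂ (triangleSidesDoNotInterleave (triDir (step C j))
               (pos-foreign-in A disjoint′ j i (sym meet)) (pos-foreign-out A disjoint′ j i (sym meet)))
        (cyclicOrder-cong (trans (cong (deg G′) meet) (deg-corner j)) refl (pos-in j) refl (pos-out j) co)
      where
      disjoint′ : EdgeDisjoint C A
      disjoint′ = edgeDisjoint-sym {G′} mate′-involutive {A} {C} disjoint

  module Contraction (C : Cycle G′) (i₀ : Fin (suc (len C))) (original-i₀ : isOriginal (step C i₀) ≡ true) where
    open Walk C public

    -- orig p is the index of the p-th original step after start, detour k the number of
    -- triangle steps following step k, and count the number of original steps in one period N.
    isOriginalAt : ℕ → Bool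
    isOriginalAt k = isOriginal (stepAt k)

    start : ℕ
    start = toℕ i₀

    detour : ℕ → ℕ
    detour k = firstTrue (λ j → isOriginalAt (suc (k + j))) (len C)

    detour-≤ : ∀ k → detour k ≤ len C
    detour-≤ k = firstTrue-≤ (λ j → isOriginalAt (suc (k + j))) (len C)

    detour-triangular : ∀ k {j} → j < detour k → Triangular (stepAt (suc (k + j)))
    detour-triangular k = firstTrue-minimal (λ j → isOriginalAt (suc (k + j))) (len C)

    orig : ℕ → ℕ
    orig zero    = start
    orig (suc p) = suc (orig p + detour (orig p))

    orig-original : ∀ p → isOriginalAt (orig p) ≡ true
    orig-original zero    = subst (λ i → isOriginal (step C i) ≡ true) (sym (unroll-toℕ i₀)) original-i₀
    orig-original (suc p) = firstTrue-true (λ j → isOriginalAt (suc (orig p + j))) (len C) ≤-refl (begin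
      isOriginalAt (suc (orig p + len C)) ≡⟨ cong isOriginalAt (sym (+-suc (orig p) (len C))) ⟩
      isOriginalAt (orig p + N)           ≡⟨ cong isOriginal (stepAt-periodic (orig p)) ⟩
      isOriginalAt (orig p)               ≡⟨ orig-original p ⟩
      true                                ∎)
      where open ≡-Reasoning

    orig-<-suc : ∀ p → orig p < orig (suc p)
    orig-<-suc p = s≤s (m≤m+n _ _)

    orig-< : ∀ {p q} → p < q → orig p < orig q
    orig-< {p} {suc q} (s≤s p≤q) with m≤n⇒m<n∨m≡n p≤q
    ... | inj₁ p<q  = <-trans (orig-< p<q) (orig-<-suc q)
    ... | inj₂ refl = orig-<-suc p

    orig-≤ : ∀ {p q} → p ≤ q → orig p ≤ orig q
    orig-≤ p≤q with m≤n⇒m<n∨m≡n p≤q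
    ... | inj₁ p<q  = <⇒≤ (orig-< p<q)
    ... | inj₂ refl = ≤-refl

    orig-injective : ∀ {p q} → orig p ≡ orig q → p ≡ q
    orig-injective {p} {q} eq with <-cmp p q
    ... | tri< p<q _ _ = ⊥-elim (<-irrefl eq (orig-< p<q))
    ... | tri≈ _ p≡q _ = p≡q
    ... | tri> _ _ q<p = ⊥-elim (<-irrefl (sym eq) (orig-< q<p))

    start+p≤orig : ∀ p → start + p ≤ orig p
    start+p≤orig zero    = ≤-reflexive (+-identityʳ start)
    start+p≤orig (suc p) = ≤-trans (≤-reflexive (+-suc start p)) (s≤s (≤-trans (start+p≤orig p) (m≤m+n _ _)))

    between-triangular : ∀ p {k} → orig p < k → k < orig (suc p) → Triangular (stepAt k)
    between-triangular p {k} op<k k<osp with m≤n⇒∃[o]m+o≡n op<k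
    ... | j , refl = detour-triangular (orig p) (+-cancelˡ-< (suc (orig p)) _ _ k<osp)

    reaches : ℕ → Bool
    reaches p = start + N ≤ᵇ orig p

    count : ℕ
    count = firstTrue reaches N

    count-reaches : start + N ≤ orig count
    count-reaches = ≤ᵇ⇒≤ _ _ (Equivalence.from T-≡
      (firstTrue-true reaches N ≤-refl (Equivalence.to T-≡ (≤⇒≤ᵇ (start+p≤orig N)))))

    orig-before-count : ∀ {p} → p < count → orig p < start + N
    orig-before-count p<count = ≰⇒> λ le → subst T (firstTrue-minimal reaches N p<count) (≤⇒≤ᵇ le)

    start<start+N : start < start + N
    start<start+N = m<m+n start (s≤s z≤n)

    count>0 : count > 0
    count>0 = n≢0⇒n>0 λ count≡0 →
      <-irrefl refl (<-≤-trans start<start+N (subst (λ p → start + N ≤ orig p) count≡0 count-reaches))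

    len′ : ℕ
    len′ = pred count

    suc-len′ : suc len′ ≡ count
    suc-len′ = suc-pred count {{>-nonZero count>0}}

    original-at-period : isOriginalAt (start + N) ≡ true
    original-at-period = trans (cong isOriginal (stepAt-periodic start)) (orig-original 0)

    orig-count : orig count ≡ start + N
    orig-count = ≤-antisym (subst (λ p → orig p ≤ start + N) suc-len′ last-≤) count-reaches
      where
      reaches′ : start + N ≤ orig (suc len′)
      reaches′ = subst (λ p → start + N ≤ orig p) (sym suc-len′) count-reaches
      last-≤ : orig (suc len′) ≤ start + N
      last-≤ with m≤n⇒m<n∨m≡n reaches′
      ... | inj₂ eq = ≤-reflexive (sym eq)
      ... | inj₁ lt with () ← trans (sym original-at-period)
                               (between-triangular len′ (orig-before-count (subst (len′ <_) suc-len′ ≤-refl)) lt)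

    originalStep : ℕ → H G
    originalStep p = original (stepAt (orig p)) (orig-original p)

    inj₁-originalStep : ∀ p → inj₁ (originalStep p) ≡ stepAt (orig p)
    inj₁-originalStep p = inj₁-original _ _

    entering leaving : ℕ → H G
    entering p = mate G (originalStep p)
    leaving p = originalStep (suc p)

    detour-base : ∀ p {j} → j ≤ detour (orig p) → base (stepAt (suc (orig p + j))) ≡ at G (entering p)
    detour-base p {zero} _ = begin
      base (stepAt (suc (orig p + 0)))  ≡⟨ cong (λ k → base (stepAt (suc k))) (+-identityʳ (orig p)) ⟩
      base (stepAt (suc (orig p)))      ≡⟨ cong proj₁ (sym (stepAt-walk (orig p))) ⟩
      base (mate′ (stepAt (orig p)))    ≡⟨ cong (λ e → base (mate′ e)) (sym (inj₁-originalStep p)) ⟩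
      at G (entering p)                 ∎
      where open ≡-Reasoning
    detour-base p {suc j} j<detour = begin
      base (stepAt (suc (orig p + suc j)))  ≡⟨ cong (λ k → base (stepAt (suc k))) (+-suc (orig p) j) ⟩
      base (stepAt (suc (suc (orig p + j)))) ≡⟨ cong proj₁ (sym (stepAt-walk (suc (orig p + j)))) ⟩
      base (mate′ (stepAt (suc (orig p + j)))) ≡⟨ base-mate-triangular _ (detour-triangular (orig p) j<detour) ⟩
      base (stepAt (suc (orig p + j)))       ≡⟨ detour-base p (<⇒≤ j<detour) ⟩
      at G (entering p)                      ∎
      where open ≡-Reasoning

    leaving-at : ∀ p → at G (leaving p) ≡ at G (entering p)
    leaving-at p = trans (cong base (inj₁-originalStep (suc p))) (detour-base p ≤-refl)

    offset<next : ∀ p {t} → t ≤ detour (orig p) → orig p + t < orig (suc p)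
    offset<next p t≤d = s≤s (+-monoʳ-≤ (orig p) t≤d)

    window : ∀ {p t} → p < count → t ≤ detour (orig p) → start ≤ orig p + t × orig p + t < start + N
    window {p} p<count t≤d =
      ≤-trans (orig-≤ {0} {p} z≤n) (m≤m+n _ _) ,
      <-≤-trans (offset<next p t≤d) (≤-trans (orig-≤ p<count) (≤-reflexive orig-count))

    locate : ∀ {k} → start ≤ k → k < start + N →
             ∃ λ p → p < count × ∃ λ t → t ≤ detour (orig p) × orig p + t ≡ k
    locate {k} start≤k k<end = go count (subst (k <_) (sym orig-count) k<end)
      where
      go : ∀ P → k < orig P → ∃ λ p → p < P × ∃ λ t → t ≤ detour (orig p) × orig p + t ≡ k
      go zero    k<start = ⊥-elim (<-irrefl refl (<-≤-trans k<start start≤k))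
      go (suc P) k<next with k <? orig P
      ... | yes k<oP = let (p , p<P , rest) = go P k<oP in p , m<n⇒m<1+n p<P , rest
      ... | no  k≮oP with m≤n⇒∃[o]m+o≡n (≮⇒≥ k≮oP)
      ...   | t , eq = P , ≤-refl , t , +-cancelˡ-≤ (orig P) _ _ (≤-pred (subst (_< orig (suc P)) (sym eq) k<next)) , eq

    locate-unique : ∀ {p q t u} → t ≤ detour (orig p) → u ≤ detour (orig q) → orig p + t ≡ orig q + u → p ≡ q
    locate-unique {p} {q} t≤d u≤d eq with <-cmp p q
    ... | tri≈ _ p≡q _ = p≡q
    ... | tri< p<q _ _ = ⊥-elim (<-irrefl eq (<-≤-trans (<-≤-trans (offset<next p t≤d) (orig-≤ p<q)) (m≤m+n _ _)))
    ... | tri> _ _ q<p = ⊥-elim (<-irrefl (sym eq) (<-≤-trans (<-≤-trans (offset<next q u≤d) (orig-≤ q<p)) (m≤m+n _ _)))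

    record Position (i : Fin N) : Set where
      field
        segment offset  : ℕ
        segment<count   : segment < count
        offset≤detour   : offset ≤ detour (orig segment)
        unroll-position : unroll (orig segment + offset) ≡ i

    position : ∀ i → Position i
    position i with unroll-surjective i start
    ... | k , start≤k , k<end , unroll-k with locate start≤k k<end
    ...   | p , p<count , t , t≤d , refl = record
      { segment = p ; offset = t ; segment<count = p<count ; offset≤detour = t≤d ; unroll-position = unroll-k }

    position-unique : ∀ {p t q u} → p < count → t ≤ detour (orig p) → q < count → u ≤ detour (orig q) →
                      unroll (orig p + t) ≡ unroll (orig q + u) → p ≡ q × t ≡ u
    position-unique {p} {t} {q} {u} p<count t≤d q<count u≤d eq =
      p≡q , +-cancelˡ-≡ (orig p) _ _ (trans ks (cong (λ p → orig p + u) (sym p≡q)))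
      where
      ks : orig p + t ≡ orig q + u
      ks = unroll-injective (proj₁ (window p<count t≤d)) (proj₂ (window p<count t≤d))
                            (proj₁ (window q<count u≤d)) (proj₂ (window q<count u≤d)) eq
      p≡q : p ≡ q
      p≡q = locate-unique t≤d u≤d ks

    originalStep-≡ : ∀ p q → stepAt (orig p) ≡ stepAt (orig q) → originalStep p ≡ originalStep q
    originalStep-≡ p q eq = inj₁-injective (trans (inj₁-originalStep p) (trans eq (sym (inj₁-originalStep q))))

    originalStep-count : originalStep count ≡ originalStep 0
    originalStep-count = originalStep-≡ count 0 (trans (cong stepAt orig-count) (stepAt-periodic start))

    originalStep-next : (p : Fin (suc len′)) → originalStep (toℕ (next p)) ≡ leaving (toℕ p)
    originalStep-next p with next-cases p
    ... | inj₁ (_ , eq)      = cong originalStep eq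
    ... | inj₂ (p≡len′ , eq) = begin
      originalStep (toℕ (next p)) ≡⟨ cong originalStep eq ⟩
      originalStep 0              ≡⟨ sym originalStep-count ⟩
      originalStep count          ≡⟨ cong originalStep (trans (sym suc-len′) (cong suc (sym p≡len′))) ⟩
      leaving (toℕ p)             ∎
      where open ≡-Reasoning

    segment<count : (p : Fin (suc len′)) → toℕ p < count
    segment<count p = subst (toℕ p <_) suc-len′ (toℕ<n p)

    contraction : Cycle G
    contraction = record
      { len   = len′
      ; step  = λ p → originalStep (toℕ p)
      ; walk  = λ p → trans (sym (leaving-at (toℕ p))) (cong (at G) (sym (originalStep-next p)))
      ; trail = λ p q p≢q →
          let trail-pq = stepAt-trail-≢ (proj₁ (window₀ p)) (proj₂ (window₀ p)) (proj₁ (window₀ q))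
                                        (proj₂ (window₀ q)) (λ eq → p≢q (toℕ-injective (orig-injective eq)))
              lift-eq : ∀ {h} → originalStep (toℕ p) ≡ h → stepAt (orig (toℕ p)) ≡ inj₁ h
              lift-eq eq = trans (sym (inj₁-originalStep (toℕ p))) (cong inj₁ eq)
          in (λ eq → proj₁ trail-pq (trans (lift-eq eq) (inj₁-originalStep (toℕ q)))) ,
             (λ eq → proj₂ trail-pq (trans (lift-eq eq) (cong mate′ (inj₁-originalStep (toℕ q)))))
      }
      where
      window₀ : (p : Fin (suc len′)) → start ≤ orig (toℕ p) × orig (toℕ p) < start + N
      window₀ p = subst (λ k → start ≤ k × k < start + N) (+-identityʳ _) (window (segment<count p) z≤n)

    entering≢leaving : ∀ p → entering p ≢ leaving p
    entering≢leaving p eq with m≤n⇒m<n∨m≡n next≤period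
      where
      next≤period : orig (suc p) ≤ orig p + N
      next≤period = subst (orig (suc p) ≤_) (sym (+-suc (orig p) (len C))) (s≤s (+-monoʳ-≤ (orig p) (detour-≤ (orig p))))
    ... | inj₁ lt = proj₂ (stepAt-trail (orig-<-suc p) lt) (begin
      stepAt (orig p)                        ≡⟨ sym (inj₁-originalStep p) ⟩
      inj₁ (originalStep p)                  ≡⟨ cong inj₁ (sym (mate-invol _)) ⟩
      inj₁ (mate G (entering p))             ≡⟨ cong (λ h → inj₁ (mate G h)) eq ⟩
      mate′ (inj₁ (leaving p))               ≡⟨ cong mate′ (inj₁-originalStep (suc p)) ⟩
      mate′ (stepAt (orig (suc p)))          ∎)
      where open ≡-Reasoning
    ... | inj₂ full = mate-nofix (originalStep p)
      (trans eq (originalStep-≡ (suc p) p (trans (cong stepAt full) (stepAt-periodic (orig p)))))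

    passageIn passageOut : ℕ → ℕ → H′
    passageIn  p t = mate′ (stepAt (orig p + t))
    passageOut p t = stepAt (suc (orig p + t))

    passageIn-0 : ∀ p → passageIn p 0 ≡ inj₁ (entering p)
    passageIn-0 p = trans (cong (λ k → mate′ (stepAt k)) (+-identityʳ (orig p))) (cong mate′ (sym (inj₁-originalStep p)))

    passageIn-suc : ∀ p t → passageIn p (suc t) ≡ mate′ (passageOut p t)
    passageIn-suc p t = cong (λ k → mate′ (stepAt k)) (+-suc (orig p) t)

    passageOut-detour : ∀ p → passageOut p (detour (orig p)) ≡ inj₁ (leaving p)
    passageOut-detour p = sym (inj₁-originalStep (suc p))

    passage-walk : ∀ p t → at′ (passageIn p t) ≡ at′ (passageOut p t)
    passage-walk p t = stepAt-walk (orig p + t)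

    passageOut-no-backtracking : ∀ p t → passageOut p (suc t) ≢ mate′ (passageOut p t)
    passageOut-no-backtracking p t eq =
      no-backtracking (suc (orig p + t)) (trans (cong (λ k → stepAt (suc k)) (sym (+-suc (orig p) t))) eq)

    module FourSegment (p : ℕ) (four : deg G (at G (entering p)) ≡ 4) where

      detour≡0 : detour (orig p) ≡ 0
      detour≡0 with detour (orig p) in eq
      ... | zero  = refl
      ... | suc _ with () ← trans (sym four) (trans (cong (deg G) (sym (detour-base p z≤n)))
                              (triangular-deg _ (detour-triangular (orig p) (subst (0 <_) (sym eq) (s≤s z≤n)))))

      passageOut-0 : passageOut p 0 ≡ inj₁ (leaving p)
      passageOut-0 = subst (λ t → passageOut p t ≡ inj₁ (leaving p)) detour≡0 (passageOut-detour p)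

      leaving-four : deg G (at G (leaving p)) ≡ 4
      leaving-four = trans (cong (deg G) (leaving-at p)) four

      out-base : base (passageOut p 0) ≡ at G (leaving p)
      out-base = cong base passageOut-0

      out-corner : cornerOf (at′ (passageOut p 0)) ≡ 0
      out-corner = trans (cong (λ e → cornerOf (at′ e)) passageOut-0) (block-4 leaving-four _ _)

      out-deg : deg G′ (at′ (passageOut p 0)) ≡ deg G (at G (leaving p))
      out-deg = trans (cong (λ e → deg G′ (at′ e)) passageOut-0) (trans (newdeg-4 leaving-four) (sym leaving-four))

      in-pos : pos′ (passageIn p 0) ≡ pos G (entering p)
      in-pos = trans (cong pos′ (passageIn-0 p)) (newpos-4 four _ _)

      out-pos : pos′ (passageOut p 0) ≡ pos G (leaving p)
      out-pos = trans (cong pos′ passageOut-0) (newpos-4 leaving-four _ _)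

    module SixSegment (p : ℕ) (a : V G) (entering-at : at G (entering p) ≡ a) (six : deg G a ≡ 6) where

      b : Bool
      b = c a

      m : ℕ
      m = detour (orig p)

      out : ℕ → H′
      out = passageOut p

      P : Passage
      P = passage (pos G (entering p)) (pos G (leaving p)) m (triDir (out 0))

      leaving-at-a : at G (leaving p) ≡ a
      leaving-at-a = trans (leaving-at p) entering-at

      out-walk : ∀ t → at′ (mate′ (out t)) ≡ at′ (out (suc t))
      out-walk t = trans (sym (cong at′ (passageIn-suc p t))) (passage-walk p (suc t))

      out-dir : ∀ {t} → t < m → triDir (out t) ≡ dir P
      out-dir {zero}  _   = refl
      out-dir {suc t} t<m = trans
        (triDir-step (detour-triangular (orig p) (<-trans (n<1+n t) t<m)) (detour-triangular (orig p) t<m)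
                     (out-walk t) (passageOut-no-backtracking p t))
        (out-dir (<-trans (n<1+n t) t<m))

      open LocalCoordinates six

      out-triCorner : ∀ {t} → t < m → triCorner (out t) ≡ corner b P t
      out-corner : ∀ {t} → t ≤ m → cornerOf (at′ (out t)) ≡ toℕ (corner b P t)
      out-corner {zero}  _   = begin
        cornerOf (at′ (out 0))                ≡⟨ cong cornerOf (sym (passage-walk p 0)) ⟩
        cornerOf (at′ (passageIn p 0))        ≡⟨ cong (λ e → cornerOf (at′ e)) (passageIn-0 p) ⟩
        cornerOf (at′ (inj₁ (entering p)))    ≡⟨ corner-slot (inj₁ (entering p)) entering-at ⟩
        toℕ (corner b P 0)                    ∎
        where open ≡-Reasoning
      out-corner {suc t} t<m = begin
        cornerOf (at′ (out (suc t)))                   ≡⟨ cong cornerOf (sym (out-walk t)) ⟩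
        cornerOf (at′ (mate′ (out t)))                 ≡⟨ cornerOf-mate-triangular _ (detour-triangular (orig p) t<m) ⟩
        toℕ (turn (triDir (out t)) (triCorner (out t))) ≡⟨ cong toℕ (cong₂ turn (out-dir t<m) (out-triCorner t<m)) ⟩
        toℕ (corner b P (suc t))                       ∎
        where open ≡-Reasoning

      out-triCorner t<m =
        toℕ-injective (trans (sym (cornerOf-triangular _ (detour-triangular (orig p) t<m))) (out-corner (<⇒≤ t<m)))

      out-slot : ∀ {t} → t < m → slotOf (out t) ≡ innerStep b P t
      out-slot t<m = trans (slotOf-triangular _ (detour-triangular (orig p) t<m)) (cong₂ inner (out-triCorner t<m) (out-dir t<m))

      mate-out-slot : ∀ {t} → t < m → slotOf (mate′ (out t)) ≡ slotMate (innerStep b P t)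
      mate-out-slot t<m = trans (slotOf-mate-triangular _ (detour-triangular (orig p) t<m)) (cong slotMate (out-slot t<m))

      out-base : ∀ {t} → t ≤ m → base (out t) ≡ a
      out-base t≤m = trans (detour-base p t≤m) entering-at

      in-base : ∀ {t} → t ≤ m → base (passageIn p t) ≡ a
      in-base t≤m = trans (cong proj₁ (passage-walk p _)) (out-base t≤m)

      out-slotOf : ∀ {t} → t ≤ m → slotOf (out t) ≡ outSlot b P t
      out-slotOf {t} t≤m with m≤n⇒m<n∨m≡n t≤m
      ... | inj₁ t<m  = trans (out-slot t<m) (sym (outSlot-< b P t<m))
      ... | inj₂ refl = trans (cong slotOf (passageOut-detour p)) (sym (outSlot-steps b P))

      in-slotOf : ∀ {t} → t ≤ m → slotOf (passageIn p t) ≡ inSlot b P t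
      in-slotOf {zero}  _   = cong slotOf (passageIn-0 p)
      in-slotOf {suc t} t<m = begin
        slotOf (passageIn p (suc t))   ≡⟨ cong slotOf (passageIn-suc p t) ⟩
        slotOf (mate′ (out t))         ≡⟨ mate-out-slot t<m ⟩
        inSlot b P (suc t)             ∎
        where open ≡-Reasoning

      out-corner-slot : ∀ {t} → t ≤ m → cornerOf (at′ (out t)) ≡ toℕ (slotCorner b (outSlot b P t))
      out-corner-slot t≤m = trans (corner-slot (out _) (out-base t≤m)) (cong (λ s → toℕ (slotCorner b s)) (out-slotOf t≤m))

      out-pos : ∀ {t} → t ≤ m → pos′ (out t) ≡ slotPos b (outSlot b P t)
      out-pos t≤m = trans (pos-slot (out _) (out-base t≤m)) (cong (slotPos b) (out-slotOf t≤m))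

      in-pos : ∀ {t} → t ≤ m → pos′ (passageIn p t) ≡ slotPos b (inSlot b P t)
      in-pos t≤m = trans (pos-slot (passageIn p _) (in-base t≤m)) (cong (slotPos b) (in-slotOf t≤m))

      private
        -- Four triangle steps in one direction would return to the half-edge of the first.
        steps<4 : m < 4
        steps<4 = ≰⇒> λ 4≤m → proj₁ (stepAt-trail x<y (y<x+N 4≤m)) (out0≡out3 4≤m)
          where
          x<y : suc (orig p + 0) < suc (orig p + 3)
          x<y = s≤s (+-monoʳ-< (orig p) (s≤s z≤n))
          y<x+N : 4 ≤ m → suc (orig p + 3) < suc (orig p + 0) + N
          y<x+N 4≤m = s≤s (subst (λ k → orig p + 3 < k + N) (sym (+-identityʳ (orig p)))
                            (+-monoʳ-< (orig p) (s≤s (≤-trans (≤-trans (n≤1+n 3) 4≤m) (detour-≤ (orig p))))))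
          out0≡out3 : 4 ≤ m → out 0 ≡ out 3
          out0≡out3 4≤m = triangular-≡ (detour-triangular (orig p) 0<m) (detour-triangular (orig p) 4≤m)
            (vertex-≡ _ _ (trans (out-base z≤n) (sym (out-base 3≤m)))
              (trans (out-corner z≤n) (trans (cong toℕ (sym (turn³ (dir P) (corner b P 0)))) (sym (out-corner 3≤m)))))
            (trans (out-dir 0<m) (sym (out-dir 4≤m)))
            where
            0<m : 0 < m
            0<m = ≤-trans (s≤s z≤n) 4≤m
            3≤m : 3 ≤ m
            3≤m = ≤-trans (n≤1+n 3) 4≤m

      proper : Proper b P
      proper = subst (pos G (entering p) <_) (trans (cong (deg G) entering-at) six) (pos-bound (entering p)) ,
               subst (pos G (leaving p) <_) (trans (cong (deg G) leaving-at-a) six) (pos-bound (leaving p)) ,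
               steps<4 ,
               (λ eq → entering≢leaving p (pos-inj _ _ (sym (leaving-at p)) eq)) ,
               toℕ-injective (begin
                 toℕ (block6 b (pos G (leaving p)))   ≡⟨ sym (corner-slot (inj₁ (leaving p)) leaving-at-a) ⟩
                 cornerOf (at′ (inj₁ (leaving p)))    ≡⟨ cong (λ e → cornerOf (at′ e)) (sym (passageOut-detour p)) ⟩
                 cornerOf (at′ (out m))               ≡⟨ out-corner ≤-refl ⟩
                 toℕ (corner b P m)                   ∎)
        where open ≡-Reasoning

  module Transfer (valency : ∀ a → deg G a ≡ 4 ⊎ deg G a ≡ 6) (A B : Cycle G′) (disjoint : EdgeDisjoint A B)
                  (iA : Fin (suc (len A))) (original-iA : isOriginal (step A iA) ≡ true)
                  (iB : Fin (suc (len B))) (original-iB : isOriginal (step B iB) ≡ true) where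
    module CA = Contraction A iA original-iA
    module CB = Contraction B iB original-iB

    LiftedCrossing : ℕ → ℕ → ℕ → ℕ → Set
    LiftedCrossing p q t l = Crossing A B (CA.unroll (CA.orig p + t)) (CB.unroll (CB.orig q + l))

    PassagesCross : H G → H G → H G → H G → Set
    PassagesCross inA inB outA outB =
      (at G outA ≡ at G outB) × CyclicOrder (deg G (at G outA)) (pos G inA) (pos G inB) (pos G outA) (pos G outB)

    ContractedCrossing : ℕ → ℕ → Set
    ContractedCrossing p q = PassagesCross (CA.entering p) (CB.entering q) (CA.leaving p) (CB.leaving q)

    disjointAt : ∀ k l → (CA.stepAt k ≢ CB.stepAt l) × (CA.stepAt k ≢ mate′ (CB.stepAt l))
    disjointAt k l = disjoint (CA.unroll k) (CB.unroll l)

    original-≢ : ∀ p q → CA.originalStep p ≢ CB.originalStep q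
    original-≢ p q eq = proj₁ (disjointAt (CA.orig p) (CB.orig q))
      (trans (sym (CA.inj₁-originalStep p)) (trans (cong inj₁ eq) (CB.inj₁-originalStep q)))

    original-≢-mate : ∀ p q → CA.originalStep p ≢ mate G (CB.originalStep q)
    original-≢-mate p q eq = proj₂ (disjointAt (CA.orig p) (CB.orig q))
      (trans (sym (CA.inj₁-originalStep p)) (trans (cong inj₁ eq) (cong mate′ (CB.inj₁-originalStep q))))

    meeting-vertex : ∀ p q {t l} → t ≤ CA.detour (CA.orig p) → l ≤ CB.detour (CB.orig q) →
                     LiftedCrossing p q t l → at G (CA.entering p) ≡ at G (CB.entering q)
    meeting-vertex p q t≤d l≤d (meet , _) =
      trans (sym (CA.detour-base p t≤d)) (trans (cong proj₁ meet) (CB.detour-base q l≤d))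

    contracted-meeting-vertex : ∀ p q → ContractedCrossing p q → at G (CA.entering p) ≡ at G (CB.entering q)
    contracted-meeting-vertex p q (meet , _) = trans (sym (CA.leaving-at p)) (trans meet (CB.leaving-at q))

    module FourVertex (p q : ℕ) (meet : at G (CA.entering p) ≡ at G (CB.entering q))
                      (four : deg G (at G (CA.entering p)) ≡ 4) where
      module SA = CA.FourSegment p four
      module SB = CB.FourSegment q (trans (cong (deg G) (sym meet)) four)

      descend : LiftedCrossing p q 0 0 → ContractedCrossing p q
      descend (meet′ , co) =
        trans (sym SA.out-base) (trans (cong proj₁ meet′) SB.out-base) ,
        cyclicOrder-cong SA.out-deg SA.in-pos SB.in-pos SA.out-pos SB.out-pos co

      lift : ContractedCrossing p q → LiftedCrossing p q 0 0
      lift (meet′ , co) =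
        vertex-≡ _ _ (trans SA.out-base (trans meet′ (sym SB.out-base))) (trans SA.out-corner (sym SB.out-corner)) ,
        cyclicOrder-cong (sym SA.out-deg) (sym SA.in-pos) (sym SB.in-pos) (sym SA.out-pos) (sym SB.out-pos) co

    module SixVertex (p q : ℕ) (a : V G) (atA : at G (CA.entering p) ≡ a) (atB : at G (CB.entering q) ≡ a)
                     (six : deg G a ≡ 6) where
      module SA = CA.SixSegment p a atA six
      module SB = CB.SixSegment q a atB six

      b : Bool
      b = c a

      private
        same-at : ∀ {h h′} → at G h ≡ a → at G h′ ≡ a → pos G h ≡ pos G h′ → h ≡ h′
        same-at h-at h′-at eq = pos-inj _ _ (trans h-at (sym h′-at)) eq

        mate-cancel : ∀ {h h′} → mate G h ≡ mate G h′ → h ≡ h′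
        mate-cancel {h} {h′} eq = trans (sym (mate-invol h)) (trans (cong (mate G) eq) (mate-invol h′))

        out-disjoint : ∀ t l → (SA.out t ≢ SB.out l) × (SA.out t ≢ mate′ (SB.out l))
        out-disjoint t l = disjointAt (suc (CA.orig p + t)) (suc (CB.orig q + l))

      edgeDisjointPassages : EdgeDisjointPassages b SA.P SB.P
      edgeDisjointPassages =
        (λ eq → original-≢ p q (mate-cancel (same-at atA atB eq))) ,
        (λ eq → original-≢-mate p (suc q) (trans (sym (mate-invol _)) (cong (mate G) (same-at atA SB.leaving-at-a eq)))) ,
        (λ eq → original-≢-mate (suc p) q (same-at SA.leaving-at-a atB eq)) ,
        (λ eq → original-≢ (suc p) (suc q) (same-at SA.leaving-at-a SB.leaving-at-a eq)) ,
        λ {t} t<m {l} l<m →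
          let out-t = CA.detour-triangular (CA.orig p) t<m
              out-l = CB.detour-triangular (CB.orig q) l<m
          in
          (λ eq → proj₁ (out-disjoint t l) (triangular-slot-≡ out-t out-l
                    (trans (SA.out-base (<⇒≤ t<m)) (sym (SB.out-base (<⇒≤ l<m))))
                    (trans (SA.out-slot t<m) (trans eq (sym (SB.out-slot l<m)))))) ,
          (λ eq → proj₂ (out-disjoint t l) (triangular-slot-≡ out-t (mate-triangular _ out-l)
                    (trans (SA.out-base (<⇒≤ t<m)) (sym (trans (base-mate-triangular _ out-l) (SB.out-base (<⇒≤ l<m)))))
                    (trans (SA.out-slot t<m) (trans eq (sym (SB.mate-out-slot l<m))))))

      private
        leaving-six : deg G (at G (CA.leaving p)) ≡ 6
        leaving-six = trans (cong (deg G) SA.leaving-at-a) six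

        deg-out : ∀ {t} → t ≤ SA.m → deg G′ (at′ (SA.out t)) ≡ 4
        deg-out t≤m = trans (cong (λ v → newdeg (deg G v)) (SA.out-base t≤m)) (newdeg-6 six)

      toLocal : ∀ {t l} → t ≤ SA.m → l ≤ SB.m → LiftedCrossing p q t l → LocalCrossing b SA.P SB.P t l
      toLocal t≤m l≤m (meet , co) =
        toℕ-injective (trans (sym (SA.out-corner-slot t≤m)) (trans (cong cornerOf meet) (SB.out-corner-slot l≤m))) ,
        cyclicOrder-cong (deg-out t≤m) (SA.in-pos t≤m) (SB.in-pos l≤m) (SA.out-pos t≤m) (SB.out-pos l≤m) co

      fromLocal : ∀ {t l} → t ≤ SA.m → l ≤ SB.m → LocalCrossing b SA.P SB.P t l → LiftedCrossing p q t l
      fromLocal t≤m l≤m (meet , co) =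
        vertex-≡ _ _ (trans (SA.out-base t≤m) (sym (SB.out-base l≤m)))
                     (trans (SA.out-corner-slot t≤m) (trans (cong toℕ meet) (sym (SB.out-corner-slot l≤m)))) ,
        cyclicOrder-cong (sym (deg-out t≤m)) (sym (SA.in-pos t≤m)) (sym (SB.in-pos l≤m))
                         (sym (SA.out-pos t≤m)) (sym (SB.out-pos l≤m)) co

      alternating⇒contracted : Alternating SA.P SB.P → ContractedCrossing p q
      alternating⇒contracted alt =
        trans SA.leaving-at-a (sym SB.leaving-at-a) ,
        subst (λ n → CyclicOrder n (entry SA.P) (entry SB.P) (exit SA.P) (exit SB.P)) (sym leaving-six) alt

      contracted⇒alternating : ContractedCrossing p q → Alternating SA.P SB.P
      contracted⇒alternating (_ , co) =
        subst (λ n → CyclicOrder n (entry SA.P) (entry SB.P) (exit SA.P) (exit SB.P)) leaving-six co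

    LocallyUnique : ℕ → ℕ → ℕ → ℕ → Set
    LocallyUnique p q t l =
      ∀ {t′} → t′ < suc (CA.detour (CA.orig p)) → ∀ {l′} → l′ < suc (CB.detour (CB.orig q)) →
      LiftedCrossing p q t′ l′ → t′ ≡ t × l′ ≡ l

    descend : ∀ p q {t l} → t ≤ CA.detour (CA.orig p) → l ≤ CB.detour (CB.orig q) →
              LiftedCrossing p q t l → LocallyUnique p q t l → ContractedCrossing p q
    descend p q {t} {l} t≤d l≤d cross unique with valency (at G (CA.entering p))
    ... | inj₁ four = FourVertex.descend p q meet four (subst₂ (LiftedCrossing p q) t≡0 l≡0 cross)
      where
      meet : at G (CA.entering p) ≡ at G (CB.entering q)
      meet = meeting-vertex p q t≤d l≤d cross
      t≡0 : t ≡ 0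
      t≡0 = n≤0⇒n≡0 (subst (t ≤_) (FourVertex.SA.detour≡0 p q meet four) t≤d)
      l≡0 : l ≡ 0
      l≡0 = n≤0⇒n≡0 (subst (l ≤_) (FourVertex.SB.detour≡0 p q meet four) l≤d)
    ... | inj₂ six = X.alternating⇒contracted
      (proj₂ (parityLaw X.b X.SA.P X.SB.P X.SA.proper X.SB.proper X.edgeDisjointPassages)
        (s≤s t≤d) (s≤s l≤d) (X.toLocal t≤d l≤d cross)
        λ t′<d l′<d local → unique t′<d l′<d (X.fromLocal (≤-pred t′<d) (≤-pred l′<d) local))
      where module X = SixVertex p q _ refl (sym (meeting-vertex p q t≤d l≤d cross)) six

    lift : ∀ p q → ContractedCrossing p q →
           ∃ λ t → t ≤ CA.detour (CA.orig p) × ∃ λ l → l ≤ CB.detour (CB.orig q) × LiftedCrossing p q t l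
    lift p q cross with valency (at G (CA.entering p))
    ... | inj₁ four = 0 , z≤n , 0 , z≤n , FourVertex.lift p q (contracted-meeting-vertex p q cross) four cross
    ... | inj₂ six = lift-local (proj₁ (parityLaw X.b X.SA.P X.SB.P X.SA.proper X.SB.proper X.edgeDisjointPassages)
                                       (X.contracted⇒alternating cross))
      where
      module X = SixVertex p q _ refl (sym (contracted-meeting-vertex p q cross)) six
      lift-local : SomeLocalCrossing X.b X.SA.P X.SB.P →
                   ∃ λ t → t ≤ CA.detour (CA.orig p) × ∃ λ l → l ≤ CB.detour (CB.orig q) × LiftedCrossing p q t l
      lift-local (t , t<d , l , l<d , local) = t , ≤-pred t<d , l , ≤-pred l<d , X.fromLocal (≤-pred t<d) (≤-pred l<d) local

    contraction-disjoint : EdgeDisjoint CA.contraction CB.contraction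
    contraction-disjoint p q = original-≢ (toℕ p) (toℕ q) , original-≢-mate (toℕ p) (toℕ q)

    contracted⇒crossing : ∀ p q → ContractedCrossing (toℕ p) (toℕ q) → Crossing CA.contraction CB.contraction p q
    contracted⇒crossing p q = subst₂ (PassagesCross (CA.entering (toℕ p)) (CB.entering (toℕ q)))
                                      (sym (CA.originalStep-next p)) (sym (CB.originalStep-next q))

    crossing⇒contracted : ∀ p q → Crossing CA.contraction CB.contraction p q → ContractedCrossing (toℕ p) (toℕ q)
    crossing⇒contracted p q = subst₂ (PassagesCross (CA.entering (toℕ p)) (CB.entering (toℕ q)))
                                      (CA.originalStep-next p) (CB.originalStep-next q)

    module _ (i : Fin (suc (len A))) (j : Fin (suc (len B))) (cross : Crossing A B i j)
             (unique : ∀ i′ j′ → Crossing A B i′ j′ → i′ ≡ i × j′ ≡ j) where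
      private
        module PA = CA.Position (CA.position i)
        module PB = CB.Position (CB.position j)

        p q : ℕ
        p = PA.segment
        q = PB.segment

        lifted : ∀ {p′ t′ q′ l′} → p′ < CA.count → t′ ≤ CA.detour (CA.orig p′) →
                 q′ < CB.count → l′ ≤ CB.detour (CB.orig q′) → LiftedCrossing p′ q′ t′ l′ → (p′ ≡ p × t′ ≡ PA.offset) × (q′ ≡ q × l′ ≡ PB.offset)
        lifted {p′} {t′} {q′} {l′} p′<c t′≤d q′<c l′≤d cross′ =
          CA.position-unique p′<c t′≤d PA.segment<count PA.offset≤detour (trans (proj₁ unique′) (sym PA.unroll-position)) ,
          CB.position-unique q′<c l′≤d PB.segment<count PB.offset≤detour (trans (proj₂ unique′) (sym PB.unroll-position))
          where
          unique′ : CA.unroll (CA.orig p′ + t′) ≡ i × CB.unroll (CB.orig q′ + l′) ≡ j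
          unique′ = unique (CA.unroll (CA.orig p′ + t′)) (CB.unroll (CB.orig q′ + l′)) cross′

        contracted : ContractedCrossing p q
        contracted = descend p q PA.offset≤detour PB.offset≤detour
          (subst₂ (Crossing A B) (sym PA.unroll-position) (sym PB.unroll-position) cross)
          λ t′<d l′<d cross′ →
            let ((_ , t′≡) , (_ , l′≡)) = lifted PA.segment<count (≤-pred t′<d) PB.segment<count (≤-pred l′<d) cross′
            in t′≡ , l′≡

        p<len : p < suc CA.len′
        p<len = subst (p <_) (sym CA.suc-len′) PA.segment<count

        q<len : q < suc CB.len′
        q<len = subst (q <_) (sym CB.suc-len′) PB.segment<count

      contracted-obstruct : VassilievObstruct G
      contracted-obstruct =
        CA.contraction , CB.contraction , contraction-disjoint , fromℕ< p<len , fromℕ< q<len ,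
        contracted⇒crossing (fromℕ< p<len) (fromℕ< q<len)
          (subst₂ ContractedCrossing (sym (toℕ-fromℕ< p<len)) (sym (toℕ-fromℕ< q<len)) contracted) ,
        λ p″ q″ cross″ →
          let (t , t≤d , l , l≤d , lifted-cross) = lift (toℕ p″) (toℕ q″) (crossing⇒contracted p″ q″ cross″)
              ((p″≡p , _) , (q″≡q , _)) = lifted (CA.segment<count p″) t≤d (CB.segment<count q″) l≤d lifted-cross
          in toℕ-injective (trans p″≡p (sym (toℕ-fromℕ< p<len))) ,
             toℕ-injective (trans q″≡q (sym (toℕ-fromℕ< q<len)))

  originalOrTriangular : (C : Cycle G′) → (∃ λ i → isOriginal (step C i) ≡ true) ⊎ (∀ i → Triangular (step C i))
  originalOrTriangular C with any? (λ i → isOriginal (step C i) Bool.≟ true)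
  ... | yes found = inj₁ found
  ... | no  none  = inj₂ λ i → Bool.¬-not λ eq → none (i , eq)

lemma2 : (G : StarGraph) → WellFormed G
       → (∀ a → (deg G a ≡ 4) ⊎ (deg G a ≡ 6))
       → (c : V G → Bool)
       → VassilievObstruct (expand G c) → VassilievObstruct G
lemma2 G wf valency c = contract
  where
  open Expansion G wf c

  contract : VassilievObstruct G′ → VassilievObstruct G
  contract (A , B , disjoint , i , j , cross , unique) with originalOrTriangular A | originalOrTriangular B
  ... | inj₂ triangularA | _ =
    ⊥-elim (TriangleCycle.no-crossing-left A triangularA B disjoint i j cross)
  ... | inj₁ _ | inj₂ triangularB =
    ⊥-elim (TriangleCycle.no-crossing-right B triangularB A disjoint i j cross)
  ... | inj₁ (iA , original-iA) | inj₁ (iB , original-iB) =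
    Transfer.contracted-obstruct valency A B disjoint iA original-iA iB original-iB i j cross unique
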